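{- Let $q$ be an odd prime power, $d\ge 2$, $t\in\mathbb{F}_q^*$, and $E\subseteq\mathbb{F}_q^d$ nonempty. Let $H$ be a finite simple graph with vertex set $V$, let $S=\{v_1,\dots,v_n\}\subseteq V$, write $V\setminus S=\{w_1,\dots,w_l\}$, let $k\ge 1$, and let $G$ be the $k$-Hölder extension of $H$ with respect to $S$. Then \[ \mathcal N_G(E)\ \ge\ \frac{(\mathcal N_H(E))^k}{|E|^{(k-1)l}}. \]
   Context: For $x\in\mathbb{F}_q^d$, $\lVert x\rVert=x_1^2+\dots+x_d^2$. All edges of all graphs are assigned the same length $t$. An embedding of a graph $\Gamma=(V_\Gamma,E_\Gamma)$ in $E$ is a map $\varphi:V_\Gamma\to E$ such that $\lVert\varphi(u)-\varphi(w)\rVert=t$ for every edge $uw\in E_\Gamma$ (not required to be injective); $\mathcal N_\Gamma(E)$ is the number of such maps. The $k$-Hölder extension of $H$ with respect to $S$ is the graph $G$ whose vertex set is $V$ together with $k-1$ new copies $\{v_j^i:1\le j\le n,\ 1\le i\le k-1\}$ of the vertices of $S$; its edges are the edges of $H$ (on $V\times V$), together with: $v_j^i$ adjacent to $w\in V\setminus S$ iff $v_j$ is adjacent to $w$ in $H$, and $v_j^i$ adjacent to $v_{j'}^{i}$ (same copy index $i$) iff $v_j$ is adjacent to $v_{j'}$ in $H$; there are no other edges. (For $k=1$, $G=H$.) -}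

module Defs where

open import Level using (Level; _⊔_)
open import Data.Nat using (ℕ; zero; suc)
import Data.Nat as Nat
open Nat using (_∸_; _^_; _≤_)
open import Data.Nat.Primality using (Prime)
open import Data.Fin using (Fin; zero; suc; splitAt; remQuot)
import Data.Fin
open import Data.Bool using (Bool; true; false; _∧_; if_then_else_)
open import Data.Sum using (_⊎_; inj₁; inj₂)
open import Data.Product using (Σ; ∃; _×_; _,_)
open import Data.Empty using (⊥)
open import Relation.Nullary using (¬_; Dec; yes; no)
open import Relation.Nullary.Decidable using (⌊_⌋)
open import Relation.Binary using (Decidable)
open import Relation.Binary.PropositionalEquality using (_≡_; _≢_)
import Relation.Binary.PropositionalEquality as Eq
open import Algebra.Bundles using (CommutativeRing)
open import Function.Bundles using (Bijection)

OddPrimePower : ℕ → Set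
OddPrimePower q = Σ ℕ λ p → Σ ℕ λ r → Prime p × p ≢ 2 × 1 ≤ r × q ≡ p ^ r

-- A commutative ring F is a finite field with exactly q elements
-- (equality on F is decidable, which holds for any finite field).
record IsFiniteField {c ℓ : Level} (F : CommutativeRing c ℓ) (q : ℕ) : Set (c ⊔ ℓ) where
  open CommutativeRing F
  field
    0≉1      : ¬ (0# ≈ 1#)
    inverse  : ∀ x → ¬ (x ≈ 0#) → Σ Carrier λ y → (x * y) ≈ 1#
    _≟_      : Decidable _≈_
    card     : Bijection setoid (Eq.setoid (Fin q))

record SimpleGraph (m : ℕ) : Set where
  field
    adj   : Fin m → Fin m → Bool
    sym   : ∀ u w → adj u w ≡ adj w u
    irrefl : ∀ u → adj u u ≡ false

open SimpleGraph public

allFin : (N : ℕ) → (Fin N → Bool) → Bool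
allFin zero    P = true
allFin (suc N) P = P zero ∧ allFin N (λ i → P (suc i))

sumFin : (e : ℕ) → (Fin e → ℕ) → ℕ
sumFin zero    f = 0
sumFin (suc e) f = f zero Nat.+ sumFin e (λ i → f (suc i))

cons : ∀ {N e} → Fin e → (Fin N → Fin e) → Fin (suc N) → Fin e
cons x f zero    = x
cons x f (suc i) = f i

countMaps : (N e : ℕ) → ((Fin N → Fin e) → Bool) → ℕ
countMaps zero    e P = if P (λ ()) then 1 else 0
countMaps (suc N) e P = sumFin e (λ x → countMaps N e (λ f → P (cons x f)))

module _ {c ℓ : Level} (F : CommutativeRing c ℓ) where
  open CommutativeRing F

  norm : (d : ℕ) → (Fin d → Carrier) → Carrier
  norm zero    x = 0#
  norm (suc d) x = (x Data.Fin.zero * x Data.Fin.zero) + norm d (λ i → x (Data.Fin.suc i))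

  dist : (d : ℕ) → (Fin d → Carrier) → (Fin d → Carrier) → Carrier
  dist d x y = norm d (λ i → x i + (- y i))

  -- E = {E 0, …, E (e-1)} ⊆ F^d, listed without repetition.
  -- N_Γ(E): number of maps φ : V_Γ → E with ‖φ u - φ w‖ = t for all edges uw.
  -- (A map into E is encoded as a map into the index set Fin e; since
  --  the listing is injective this is a bijection with maps V_Γ → E.)
  embCount : (_≟_ : Decidable _≈_) (d : ℕ) (t : Carrier) {e : ℕ}
             (E : Fin e → (Fin d → Carrier)) {N : ℕ} (adjΓ : Fin N → Fin N → Bool) → ℕ
  embCount _≟_ d t {e} E {N} adjΓ =
    countMaps N e λ φ →
      allFin N λ u → allFin N λ w →
        if adjΓ u w then ⌊ dist d (E (φ u)) (E (φ w)) ≟ t ⌋ else true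

-- H is a graph on V = Fin m, S = {s 0, …, s (n-1)} given by an injective
-- s : Fin n → Fin m.  The extension has vertex set
--   Fin m ⊎ (Fin (k ∸ 1) × Fin n)  ≅  Fin (m Nat.+ (k ∸ 1) Nat.* n),
-- where (i , j) is the copy v_j^{i}.

module _ {m n : ℕ} (H : SimpleGraph m) (s : Fin n → Fin m) (k : ℕ) where

  inS : Fin m → Bool
  inS v = anyS n s
    where
      anyS : (n' : ℕ) → (Fin n' → Fin m) → Bool
      anyS zero    g = false
      anyS (suc n') g = if ⌊ g zero Data.Fin.≟ v ⌋ then true else anyS n' (λ i → g (suc i))

  HVert : Set
  HVert = Fin m ⊎ (Fin (k ∸ 1) × Fin n)

  extAdj' : HVert → HVert → Bool
  extAdj' (inj₁ u) (inj₁ w) = adj H u w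
  extAdj' (inj₁ u) (inj₂ (i , j)) = if inS u then false else adj H (s j) u
  extAdj' (inj₂ (i , j)) (inj₁ w) = if inS w then false else adj H (s j) w
  extAdj' (inj₂ (i , j)) (inj₂ (i' , j')) =
    if ⌊ Data.Fin._≟_ i i' ⌋ then adj H (s j) (s j') else false

  decode : Fin (m Nat.+ (k ∸ 1) Nat.* n) → HVert
  decode x with splitAt m x
  ... | inj₁ u = inj₁ u
  ... | inj₂ y = inj₂ (remQuot n y)

  extAdj : Fin (m Nat.+ (k ∸ 1) Nat.* n) → Fin (m Nat.+ (k ∸ 1) Nat.* n) → Bool
  extAdj x y = extAdj' (decode x) (decode y)

-- For φ : V → E let c(φ) be the number of ψ : S → E such that φ overridden by ψ on S
-- embeds H; c(φ) depends only on φ restricted to V ∖ S.  An embedding of the Hölder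
-- extension is an embedding φ of H together with k − 1 independent such ψ, so
-- N_G = Σ_φ [φ embeds H] c(φ)^(k−1).  As (φ , ψ) ↦ (φ overridden by ψ , φ|_S) is an
-- involution of pairs, Σ_φ c(φ) = |E|^n N_H and Σ_φ c(φ)^k = |E|^n N_G, the sums running
-- over all |E|^m maps φ.  The power mean inequality (Σ c)^k ≤ (|E|^m)^(k−1) Σ c^k, a
-- consequence of Chebyshev's sum inequality, then gives the claim after cancelling |E|^(nk).

module Submission where

open import Defs hiding (sym)
open import Level using (Level)
open import Data.Bool using (Bool; true; false; T; _∧_; if_then_else_)
open import Data.Bool.Properties using (T-∧)
open import Data.Empty using (⊥-elim)
open import Data.Fin using (Fin; zero; suc; _↑ˡ_; _↑ʳ_; combine; remQuot; splitAt; join)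
import Data.Fin as Fin
open import Data.Fin.Properties using (any?; injective⇒≤; splitAt-↑ˡ; splitAt-↑ʳ; remQuot-combine; combine-remQuot; join-splitAt)
open import Data.Nat using (ℕ; zero; suc; _+_; _*_; _∸_; _^_; _≤_; z≤n; NonZero; >-nonZero)
open import Data.Nat.Properties
open import Data.Nat.Solver using (module +-*-Solver)
open import Data.Product using (∃; _×_; _,_; proj₁; proj₂; uncurry)
open import Data.Sum using (inj₁; inj₂; [_,_]′)
open import Data.Vec.Functional using (_++_)
open import Data.Vec.Functional.Properties using (lookup-++ˡ; lookup-++ʳ; ++-cong)
open import Function using (_∘_; _⇔_; mk⇔; Equivalence)
open import Function.Definitions using (Injective)
open import Data.Product.Function.NonDependent.Propositional using (_×-⇔_)
open import Relation.Binary.Core using (_Preserves_⟶_)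
open import Relation.Binary.PropositionalEquality
open import Relation.Nullary using (¬_; Dec; yes; no; contradiction)
open import Relation.Nullary.Decidable using (⌊_⌋; toWitness; fromWitness)
open import Algebra.Bundles using (CommutativeRing)
open import Algebra.Properties.CommutativeSemigroup *-commutativeSemigroup using (x∙yz≈y∙xz)
open import Algebra.Properties.Semiring.Sum +-*-semiring
  using (sum; sum-cong-≗; ∑-distrib-+; ∑-comm; *-distribˡ-sum; sum-replicate-zero)

open Equivalence using (to; from)
open import Function.Properties.Equivalence using () renaming (trans to infixr 5 _⟨⇔⟩_; sym to ⇔-sym)

indicator : Bool → ℕ
indicator true  = 1
indicator false = 0

indicator-∧ : ∀ a b → indicator (a ∧ b) ≡ indicator a * indicator b
indicator-∧ true  b = sym (+-identityʳ (indicator b))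
indicator-∧ false b = refl

if-then-1-else-0 : ∀ b → (if b then 1 else 0) ≡ indicator b
if-then-1-else-0 true  = refl
if-then-1-else-0 false = refl

T-injective : ∀ {a b} → T a ⇔ T b → a ≡ b
T-injective {true}  {true}  _   = refl
T-injective {true}  {false} a⇔b = ⊥-elim (to a⇔b _)
T-injective {false} {true}  a⇔b = ⊥-elim (from a⇔b _)
T-injective {false} {false} _   = refl

T-allFin : ∀ N {P : Fin N → Bool} → T (allFin N P) ⇔ (∀ i → T (P i))
T-allFin zero    = mk⇔ (λ _ ()) _
T-allFin (suc N) = mk⇔
  (λ all → let (p₀ , ps) = to T-∧ all in λ { zero → p₀ ; (suc i) → to (T-allFin N) ps i })
  (λ ps → from T-∧ (ps zero , from (T-allFin N) (ps ∘ suc)))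

allFin-cong : ∀ N {P Q : Fin N → Bool} → (∀ i → P i ≡ Q i) → allFin N P ≡ allFin N Q
allFin-cong zero    P≡Q = refl
allFin-cong (suc N) P≡Q = cong₂ _∧_ (P≡Q zero) (allFin-cong N (P≡Q ∘ suc))

Π-⇔ : ∀ {I : Set} {P Q : I → Set} → (∀ i → P i ⇔ Q i) → (∀ i → P i) ⇔ (∀ i → Q i)
Π-⇔ P⇔Q = mk⇔ (λ p i → to (P⇔Q i) (p i)) (λ q i → from (P⇔Q i) (q i))

T-if-then-true : ∀ b {x} → T (if b then x else true) ⇔ (T b → T x)
T-if-then-true true  = mk⇔ (λ x _ → x) (λ f → f _)
T-if-then-true false = mk⇔ (λ _ ()) _

T-if-else-false : ∀ b {x} → T (if b then x else false) ⇔ (T b × T x)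
T-if-else-false true  = mk⇔ (_ ,_) proj₂
T-if-else-false false = mk⇔ (λ ()) proj₁

T-unless : ∀ b {x} → T (if b then false else x) ⇔ (¬ T b × T x)
T-unless true  = mk⇔ (λ ()) (λ (¬b , _) → ¬b _)
T-unless false = mk⇔ ((λ ()) ,_) proj₂

sumFin≡sum : ∀ e (f : Fin e → ℕ) → sumFin e f ≡ sum f
sumFin≡sum zero    f = refl
sumFin≡sum (suc e) f = cong (f zero +_) (sumFin≡sum e (f ∘ suc))

sum-mono-≤ : ∀ {e} {f g : Fin e → ℕ} → (∀ x → f x ≤ g x) → sum f ≤ sum g
sum-mono-≤ {zero}  f≤g = z≤n
sum-mono-≤ {suc e} f≤g = +-mono-≤ (f≤g zero) (sum-mono-≤ (f≤g ∘ suc))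

sum-const : ∀ e c → sum {e} (λ _ → c) ≡ e * c
sum-const zero    c = refl
sum-const (suc e) c = cong (c +_) (sum-const e c)

⌊suc≟suc⌋ : ∀ {e} (x a : Fin e) → ⌊ suc x Fin.≟ suc a ⌋ ≡ ⌊ x Fin.≟ a ⌋
⌊suc≟suc⌋ x a with x Fin.≟ a
... | yes _ = refl
... | no  _ = refl

sum-delta : ∀ {e} (a : Fin e) (h : Fin e → ℕ) → sum (λ x → indicator ⌊ x Fin.≟ a ⌋ * h x) ≡ h a
sum-delta {suc e} zero    h = trans (cong₂ _+_ (+-identityʳ (h zero)) (sum-replicate-zero e))
                                    (+-identityʳ (h zero))
sum-delta {suc e} (suc a) h = trans (sum-cong-≗ λ x → cong (λ b → indicator b * h (suc x)) (⌊suc≟suc⌋ x a))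
                                    (sum-delta a (h ∘ suc))

∑Maps : (N e : ℕ) → ((Fin N → Fin e) → ℕ) → ℕ
∑Maps zero    e g = g (λ ())
∑Maps (suc N) e g = sum (λ x → ∑Maps N e (λ f → g (cons x f)))

countMaps≡∑Maps : ∀ N e P → countMaps N e P ≡ ∑Maps N e (indicator ∘ P)
countMaps≡∑Maps zero    e P = if-then-1-else-0 (P (λ ()))
countMaps≡∑Maps (suc N) e P =
  trans (sumFin≡sum e _) (sum-cong-≗ λ x → countMaps≡∑Maps N e (λ f → P (cons x f)))

cons-cong : ∀ {N e} (x : Fin e) {f f′ : Fin N → Fin e} → f ≗ f′ → cons x f ≗ cons x f′
cons-cong x f≗f′ zero    = refl
cons-cong x f≗f′ (suc i) = f≗f′ i

∑Maps-cong : ∀ {N e} {g h : (Fin N → Fin e) → ℕ} → (∀ f → g f ≡ h f) → ∑Maps N e g ≡ ∑Maps N e h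
∑Maps-cong {zero}  g≡h = g≡h _
∑Maps-cong {suc N} g≡h = sum-cong-≗ λ x → ∑Maps-cong (λ f → g≡h (cons x f))

∑Maps-distrib-+ : ∀ {N e} (g h : (Fin N → Fin e) → ℕ) →
                  ∑Maps N e (λ f → g f + h f) ≡ ∑Maps N e g + ∑Maps N e h
∑Maps-distrib-+ {zero}  g h = refl
∑Maps-distrib-+ {suc N} {e} g h =
  trans (sum-cong-≗ λ x → ∑Maps-distrib-+ (λ f → g (cons x f)) (λ f → h (cons x f))) (∑-distrib-+ {e} _ _)

*-distribˡ-∑Maps : ∀ {N e} c (g : (Fin N → Fin e) → ℕ) → c * ∑Maps N e g ≡ ∑Maps N e (λ f → c * g f)
*-distribˡ-∑Maps {zero}  c g = refl
*-distribˡ-∑Maps {suc N} {e} c g =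
  trans (*-distribˡ-sum {e} c _) (sum-cong-≗ λ x → *-distribˡ-∑Maps c (λ f → g (cons x f)))

∑Maps-mono-≤ : ∀ {N e} {g h : (Fin N → Fin e) → ℕ} → (∀ f → g f ≤ h f) → ∑Maps N e g ≤ ∑Maps N e h
∑Maps-mono-≤ {zero}  g≤h = g≤h _
∑Maps-mono-≤ {suc N} g≤h = sum-mono-≤ λ x → ∑Maps-mono-≤ (λ f → g≤h (cons x f))

∑Maps-const : ∀ N e c → ∑Maps N e (λ _ → c) ≡ e ^ N * c
∑Maps-const zero    e c = sym (+-identityʳ c)
∑Maps-const (suc N) e c = begin
  sum {e} (λ _ → ∑Maps N e (λ _ → c)) ≡⟨ sum-cong-≗ {e} (λ _ → ∑Maps-const N e c) ⟩
  sum {e} (λ _ → e ^ N * c)           ≡⟨ sum-const e (e ^ N * c) ⟩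
  e * (e ^ N * c)                     ≡⟨ *-assoc e (e ^ N) c ⟨
  e ^ suc N * c                       ∎
  where open ≡-Reasoning

sum-∑Maps-comm : ∀ {a N e} (h : Fin a → (Fin N → Fin e) → ℕ) →
                 sum (λ x → ∑Maps N e (h x)) ≡ ∑Maps N e (λ f → sum (λ x → h x f))
sum-∑Maps-comm {N = zero}  h = refl
sum-∑Maps-comm {N = suc N} h =
  trans (∑-comm (λ x y → ∑Maps N _ (λ f → h x (cons y f))))
        (sum-cong-≗ λ y → sum-∑Maps-comm (λ x f → h x (cons y f)))

∑Maps-comm : ∀ {N N′ e e′} (h : (Fin N → Fin e) → (Fin N′ → Fin e′) → ℕ) →
             ∑Maps N e (λ f → ∑Maps N′ e′ (h f)) ≡ ∑Maps N′ e′ (λ g → ∑Maps N e (λ f → h f g))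
∑Maps-comm {zero}  h = refl
∑Maps-comm {suc N} h =
  trans (sum-cong-≗ λ x → ∑Maps-comm (λ f → h (cons x f)))
        (sum-∑Maps-comm (λ x g → ∑Maps N _ (λ f → h (cons x f) g)))

++-cons : ∀ {a b e} (x : Fin e) (f : Fin a → Fin e) (h : Fin b → Fin e) → cons x (f ++ h) ≗ cons x f ++ h
++-cons x f h zero = refl
++-cons {a} x f h (suc i) with splitAt a i
... | inj₁ _ = refl
... | inj₂ _ = refl

∑Maps-split : ∀ a b e {g : (Fin (a + b) → Fin e) → ℕ} → g Preserves _≗_ ⟶ _≡_ →
              ∑Maps (a + b) e g ≡ ∑Maps a e (λ f → ∑Maps b e (λ h → g (f ++ h)))
∑Maps-split zero    b e g-cong = refl
∑Maps-split (suc a) b e g-cong = sum-cong-≗ λ x →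
  trans (∑Maps-split a b e (g-cong ∘ cons-cong x))
        (∑Maps-cong {a} λ f → ∑Maps-cong {b} λ h → g-cong (++-cons x f h))

_≗ᵇ_ : ∀ {N e} → (Fin N → Fin e) → (Fin N → Fin e) → Bool
_≗ᵇ_ {N} f g = allFin N (λ i → ⌊ f i Fin.≟ g i ⌋)

T-≗ᵇ : ∀ {N e} {f g : Fin N → Fin e} → T (f ≗ᵇ g) ⇔ f ≗ g
T-≗ᵇ {N} = mk⇔ (λ t i → toWitness (to (T-allFin N) t i))
               (λ f≗g → from (T-allFin N) (λ i → fromWitness (f≗g i)))

∑Maps-delta : ∀ {N e} (a : Fin N → Fin e) {h : (Fin N → Fin e) → ℕ} → h Preserves _≗_ ⟶ _≡_ →
              ∑Maps N e (λ f → indicator (f ≗ᵇ a) * h f) ≡ h a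
∑Maps-delta {zero}      a h-cong = trans (+-identityʳ _) (h-cong λ ())
∑Maps-delta {suc N} {e} a {h} h-cong = begin
  sum (λ x → ∑Maps N e (λ f → indicator (⌊ x Fin.≟ a zero ⌋ ∧ f ≗ᵇ tail) * h (cons x f)))
    ≡⟨ sum-cong-≗ {e} (λ x → ∑Maps-cong {N} λ f →
         trans (cong (_* h (cons x f)) (indicator-∧ ⌊ x Fin.≟ a zero ⌋ (f ≗ᵇ tail)))
               (*-assoc (indicator ⌊ x Fin.≟ a zero ⌋) (indicator (f ≗ᵇ tail)) (h (cons x f)))) ⟩
  sum (λ x → ∑Maps N e (λ f → indicator ⌊ x Fin.≟ a zero ⌋ * (indicator (f ≗ᵇ tail) * h (cons x f))))
    ≡⟨ sum-cong-≗ {e} (λ x → *-distribˡ-∑Maps {N} (indicator ⌊ x Fin.≟ a zero ⌋) _) ⟨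
  sum (λ x → indicator ⌊ x Fin.≟ a zero ⌋ * ∑Maps N e (λ f → indicator (f ≗ᵇ tail) * h (cons x f)))
    ≡⟨ sum-cong-≗ {e} (λ x → cong (indicator ⌊ x Fin.≟ a zero ⌋ *_) (∑Maps-delta tail (h-cong ∘ cons-cong x))) ⟩
  sum (λ x → indicator ⌊ x Fin.≟ a zero ⌋ * h (cons x tail))
    ≡⟨ sum-delta (a zero) _ ⟩
  h (cons (a zero) tail)
    ≡⟨ h-cong (λ { zero → refl ; (suc i) → refl }) ⟩
  h a ∎
  where
  open ≡-Reasoning
  tail = λ i → a (suc i)

∑Maps-involution : ∀ {N e} {σ : (Fin N → Fin e) → (Fin N → Fin e)} {g : (Fin N → Fin e) → ℕ} →
                   σ Preserves _≗_ ⟶ _≗_ → (∀ f → σ (σ f) ≗ f) → g Preserves _≗_ ⟶ _≡_ →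
                   ∑Maps N e (λ f → g (σ f)) ≡ ∑Maps N e g
∑Maps-involution {N} {e} {σ} {g} σ-cong σ-involutive g-cong = begin
  ∑Maps N e (λ f → g (σ f))
    ≡⟨ ∑Maps-cong {N} (λ f → ∑Maps-delta (σ f) g-cong) ⟨
  ∑Maps N e (λ f → ∑Maps N e (λ f′ → indicator (f′ ≗ᵇ σ f) * g f′))
    ≡⟨ ∑Maps-comm {N} {N} _ ⟩
  ∑Maps N e (λ f′ → ∑Maps N e (λ f → indicator (f′ ≗ᵇ σ f) * g f′))
    ≡⟨ ∑Maps-cong {N} (λ f′ → ∑Maps-cong {N} λ f → cong (λ b → indicator b * g f′) (T-injective (mk⇔ flip flip))) ⟩
  ∑Maps N e (λ f′ → ∑Maps N e (λ f → indicator (f ≗ᵇ σ f′) * g f′))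
    ≡⟨ ∑Maps-cong {N} (λ f′ → ∑Maps-delta (σ f′) (λ _ → refl)) ⟩
  ∑Maps N e g ∎
  where
  open ≡-Reasoning
  flip : ∀ {f f′} → T (f′ ≗ᵇ σ f) → T (f ≗ᵇ σ f′)
  flip {f} t = from T-≗ᵇ λ i → trans (sym (σ-involutive f i)) (σ-cong (λ j → sym (to T-≗ᵇ t j)) i)

∑Maps-allFin : ∀ j {n e} {P : (Fin n → Fin e) → Bool} → P Preserves _≗_ ⟶ _≡_ →
               ∑Maps (j * n) e (λ χ → indicator (allFin j λ i → P (λ r → χ (combine i r))))
               ≡ ∑Maps n e (indicator ∘ P) ^ j
∑Maps-allFin zero            P-cong = refl
∑Maps-allFin (suc j) {n} {e} {P} P-cong = begin
  ∑Maps (n + j * n) e (λ χ → indicator (allFin (suc j) λ i → P (λ r → χ (combine i r))))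
    ≡⟨ ∑Maps-split n (j * n) e (λ χ≗χ′ → cong indicator (allFin-cong (suc j) λ i → P-cong (χ≗χ′ ∘ combine i))) ⟩
  ∑Maps n e (λ ψ → ∑Maps (j * n) e (λ χ → indicator (allFin (suc j) λ i → P (λ r → (ψ ++ χ) (combine i r)))))
    ≡⟨ ∑Maps-cong {n} (λ ψ → ∑Maps-cong {j * n} λ χ → cong indicator (cong₂ _∧_
         (P-cong (lookup-++ˡ ψ χ))
         (allFin-cong j λ i → P-cong (lookup-++ʳ ψ χ ∘ combine i)))) ⟩
  ∑Maps n e (λ ψ → ∑Maps (j * n) e (λ χ → indicator (P ψ ∧ rest χ)))
    ≡⟨ ∑Maps-cong {n} (λ ψ → ∑Maps-cong {j * n} λ χ → indicator-∧ (P ψ) (rest χ)) ⟩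
  ∑Maps n e (λ ψ → ∑Maps (j * n) e (λ χ → indicator (P ψ) * indicator (rest χ)))
    ≡⟨ ∑Maps-cong {n} (λ ψ → *-distribˡ-∑Maps (indicator (P ψ)) (indicator ∘ rest)) ⟨
  ∑Maps n e (λ ψ → indicator (P ψ) * ∑Maps (j * n) e (indicator ∘ rest))
    ≡⟨ ∑Maps-cong {n} (λ ψ → trans (cong (indicator (P ψ) *_) (∑Maps-allFin j P-cong)) (*-comm _ (C ^ j))) ⟩
  ∑Maps n e (λ ψ → C ^ j * indicator (P ψ))
    ≡⟨ *-distribˡ-∑Maps (C ^ j) (indicator ∘ P) ⟨
  C ^ j * C
    ≡⟨ *-comm (C ^ j) C ⟩
  C ^ suc j ∎
  where
  open ≡-Reasoning
  rest = λ (χ : Fin (j * n) → Fin e) → allFin j λ i → P (λ r → χ (combine i r))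
  C = ∑Maps n e (indicator ∘ P)

-- Chebyshev's sum inequality and the power mean inequality

rearrangement : ∀ {a b c d} → a ≤ b → c ≤ d → a * d + b * c ≤ a * c + b * d
rearrangement {a} {b} {c} {d} a≤b c≤d with m≤n⇒∃[o]m+o≡n a≤b | m≤n⇒∃[o]m+o≡n c≤d
... | u , refl | v , refl = begin
  a * (c + v) + (a + u) * c     ≡⟨ solve 4 (λ a u c v → a :* (c :+ v) :+ (a :+ u) :* c
                                                      := a :* c :+ a :* v :+ u :* c :+ a :* c) refl a u c v ⟩
  a * c + a * v + u * c + a * c ≤⟨ m≤m+n _ (u * v) ⟩
  a * c + a * v + u * c + a * c + u * v
                                ≡⟨ solve 4 (λ a u c v → a :* c :+ a :* v :+ u :* c :+ a :* c :+ u :* v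
                                                      := a :* c :+ (a :+ u) :* (c :+ v)) refl a u c v ⟩
  a * c + (a + u) * (c + v)     ∎
  where
  open ≤-Reasoning
  open +-*-Solver

similarly-ordered : ∀ a b c d → (a ≤ b → c ≤ d) → (b ≤ a → d ≤ c) → a * d + c * b ≤ a * c + b * d
similarly-ordered a b c d up down with ≤-total a b
... | inj₁ a≤b = subst (_≤ a * c + b * d) (cong (a * d +_) (*-comm b c)) (rearrangement a≤b (up a≤b))
... | inj₂ b≤a = subst₂ _≤_ (trans (+-comm (b * c) (a * d)) (cong (a * d +_) (*-comm b c)))
                            (+-comm (b * d) (a * c))
                            (rearrangement b≤a (down b≤a))

∑Maps-*-∑Maps : ∀ {N e} (f g : (Fin N → Fin e) → ℕ) →
                ∑Maps N e f * ∑Maps N e g ≡ ∑Maps N e (λ x → ∑Maps N e (λ y → f x * g y))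
∑Maps-*-∑Maps {N} {e} f g = begin
  ∑Maps N e f * ∑Maps N e g                           ≡⟨ *-comm (∑Maps N e f) _ ⟩
  ∑Maps N e g * ∑Maps N e f                           ≡⟨ *-distribˡ-∑Maps {N} (∑Maps N e g) f ⟩
  ∑Maps N e (λ x → ∑Maps N e g * f x)                 ≡⟨ ∑Maps-cong {N} (λ x → *-comm _ (f x)) ⟩
  ∑Maps N e (λ x → f x * ∑Maps N e g)                 ≡⟨ ∑Maps-cong {N} (λ x → *-distribˡ-∑Maps {N} (f x) g) ⟩
  ∑Maps N e (λ x → ∑Maps N e (λ y → f x * g y))       ∎
  where open ≡-Reasoning

∑Maps-chebyshev : ∀ {N e} (f g : (Fin N → Fin e) → ℕ) → (∀ x y → f x ≤ f y → g x ≤ g y) →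
                  ∑Maps N e f * ∑Maps N e g ≤ e ^ N * ∑Maps N e (λ x → f x * g x)
∑Maps-chebyshev {N} {e} f g monotone = *-cancelˡ-≤ 2 (begin
  2 * (∑ f * ∑ g)                                        ≡⟨ cong (∑ f * ∑ g +_) (+-identityʳ _) ⟩
  ∑ f * ∑ g + ∑ f * ∑ g                                  ≡⟨ cong₂ _+_ (∑Maps-*-∑Maps f g)
                                                               (trans (*-comm (∑ f) _) (∑Maps-*-∑Maps g f)) ⟩
  ∑ (λ x → ∑ (λ y → f x * g y)) + ∑ (λ x → ∑ (λ y → g x * f y))
                                                         ≡⟨ ∑Maps-distrib-+ {N} _ _ ⟨
  ∑ (λ x → ∑ (λ y → f x * g y) + ∑ (λ y → g x * f y))    ≡⟨ ∑Maps-cong {N} (λ x → ∑Maps-distrib-+ {N} _ _) ⟨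
  ∑ (λ x → ∑ (λ y → f x * g y + g x * f y))              ≤⟨ ∑Maps-mono-≤ {N} (λ x → ∑Maps-mono-≤ {N} λ y →
                                                              similarly-ordered (f x) (f y) (g x) (g y)
                                                                (monotone x y) (monotone y x)) ⟩
  ∑ (λ x → ∑ (λ y → f x * g x + f y * g y))              ≡⟨ ∑Maps-cong {N} (λ x → ∑Maps-distrib-+ {N} _ _) ⟩
  ∑ (λ x → ∑ (λ _ → f x * g x) + ∑ (λ y → f y * g y))    ≡⟨ ∑Maps-distrib-+ {N} _ _ ⟩
  ∑ (λ x → ∑ (λ _ → f x * g x)) + ∑ (λ _ → ∑ fg)         ≡⟨ cong₂ _+_ (∑Maps-cong {N} λ x → ∑Maps-const N e _)
                                                                      (∑Maps-const N e _) ⟩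
  ∑ (λ x → e ^ N * (f x * g x)) + e ^ N * ∑ fg           ≡⟨ cong (_+ e ^ N * ∑ fg) (*-distribˡ-∑Maps {N} (e ^ N) fg) ⟨
  e ^ N * ∑ fg + e ^ N * ∑ fg                            ≡⟨ cong (e ^ N * ∑ fg +_) (+-identityʳ _) ⟨
  2 * (e ^ N * ∑ fg)                                     ∎)
  where
  open ≤-Reasoning
  ∑ = ∑Maps N e
  fg = λ x → f x * g x

∑Maps-power-mean : ∀ {N e} (f : (Fin N → Fin e) → ℕ) j →
                   ∑Maps N e f ^ suc j ≤ (e ^ N) ^ j * ∑Maps N e (λ x → f x ^ suc j)
∑Maps-power-mean {N} {e} f zero = begin
  ∑Maps N e f * 1             ≡⟨ *-identityʳ _ ⟩
  ∑Maps N e f                 ≡⟨ ∑Maps-cong {N} (λ x → *-identityʳ (f x)) ⟨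
  ∑Maps N e (λ x → f x * 1)   ≡⟨ +-identityʳ _ ⟨
  1 * ∑Maps N e (λ x → f x * 1) ∎
  where open ≤-Reasoning
∑Maps-power-mean {N} {e} f (suc j) = begin
  ∑ f * ∑ f ^ suc j                       ≤⟨ *-monoʳ-≤ (∑ f) (∑Maps-power-mean f j) ⟩
  ∑ f * (M ^ j * ∑ (λ x → f x ^ suc j))   ≡⟨ x∙yz≈y∙xz (∑ f) (M ^ j) _ ⟩
  M ^ j * (∑ f * ∑ (λ x → f x ^ suc j))   ≤⟨ *-monoʳ-≤ (M ^ j) (∑Maps-chebyshev f (λ x → f x ^ suc j)
                                                                  (λ _ _ → ^-monoˡ-≤ (suc j))) ⟩
  M ^ j * (M * ∑ (λ x → f x ^ suc (suc j))) ≡⟨ trans (x∙yz≈y∙xz (M ^ j) M _) (sym (*-assoc M (M ^ j) _)) ⟩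
  M ^ suc j * ∑ (λ x → f x ^ suc (suc j)) ∎
  where
  open ≤-Reasoning
  ∑ = ∑Maps N e
  M = e ^ N

^-distribʳ-* : ∀ a b j → (a * b) ^ j ≡ a ^ j * b ^ j
^-distribʳ-* a b zero    = refl
^-distribʳ-* a b (suc j) = trans (cong (a * b *_) (^-distribʳ-* a b j))
  (solve 4 (λ a b x y → (a :* b) :* (x :* y) := (a :* x) :* (b :* y)) refl a b (a ^ j) (b ^ j))
  where open +-*-Solver

^-*-cancelˡ-≤ : ∀ a b x y j .{{_ : NonZero a}} →
                (a * x) ^ suc j ≤ (a * b) ^ j * (a * y) → x ^ suc j ≤ y * b ^ j
^-*-cancelˡ-≤ a b x y j le = *-cancelˡ-≤ (a ^ suc j) {{m^n≢0 a (suc j)}} (begin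
  a ^ suc j * x ^ suc j      ≡⟨ ^-distribʳ-* a x (suc j) ⟨
  (a * x) ^ suc j            ≤⟨ le ⟩
  (a * b) ^ j * (a * y)      ≡⟨ cong (_* (a * y)) (^-distribʳ-* a b j) ⟩
  a ^ j * b ^ j * (a * y)    ≡⟨ solve 4 (λ a aʲ bʲ y → aʲ :* bʲ :* (a :* y) := a :* aʲ :* (y :* bʲ))
                                        refl a (a ^ j) (b ^ j) y ⟩
  a ^ suc j * (y * b ^ j)    ∎)
  where
  open ≤-Reasoning
  open +-*-Solver

module _ {X : Set} (D : X → X → Bool) where

  IsHom : {V : Set} → (V → V → Bool) → (V → X) → Set
  IsHom A φ = ∀ u w → T (A u w) → T (D (φ u) (φ w))

  subst-D : ∀ {x x′ y y′} → x ≡ x′ → y ≡ y′ → T (D x y) → T (D x′ y′)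
  subst-D refl refl t = t

  IsHom-cong : ∀ {V : Set} {A : V → V → Bool} {φ φ′ : V → X} → φ ≗ φ′ → IsHom A φ ⇔ IsHom A φ′
  IsHom-cong φ≗φ′ = mk⇔ (λ hom u w a → subst-D (φ≗φ′ u) (φ≗φ′ w) (hom u w a))
                        (λ hom u w a → subst-D (sym (φ≗φ′ u)) (sym (φ≗φ′ w)) (hom u w a))

  IsHom-reindex : ∀ {V W : Set} {A : W → W → Bool} (decode : V → W) (encode : W → V) →
                  (∀ w → decode (encode w) ≡ w) → (∀ v → encode (decode v) ≡ v) → {φ : V → X} →
                  IsHom (λ x y → A (decode x) (decode y)) φ ⇔ IsHom A (φ ∘ encode)
  IsHom-reindex {A = A} decode encode decode∘encode encode∘decode {φ} = mk⇔
    (λ hom u w a → hom (encode u) (encode w) (subst₂ (λ u′ w′ → T (A u′ w′)) (sym (decode∘encode u))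
                                                                               (sym (decode∘encode w)) a))
    (λ hom x y a → subst-D (cong φ (encode∘decode x)) (cong φ (encode∘decode y)) (hom _ _ a))

  homᵇ : ∀ {N} → (Fin N → Fin N → Bool) → (Fin N → X) → Bool
  homᵇ {N} A φ = allFin N λ u → allFin N λ w → if A u w then D (φ u) (φ w) else true

  T-homᵇ : ∀ {N} {A : Fin N → Fin N → Bool} {φ : Fin N → X} → T (homᵇ A φ) ⇔ IsHom A φ
  T-homᵇ {N} {A} = mk⇔
    (λ t u w → to (T-if-then-true (A u w)) (to (T-allFin N) (to (T-allFin N) t u) w))
    (λ hom → from (T-allFin N) λ u → from (T-allFin N) λ w → from (T-if-then-true (A u w)) (hom u w))

  homᵇ-cong : ∀ {N} {A : Fin N → Fin N → Bool} → homᵇ A Preserves _≗_ ⟶ _≡_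
  homᵇ-cong φ≗φ′ = T-injective (T-homᵇ ⟨⇔⟩ IsHom-cong φ≗φ′ ⟨⇔⟩ ⇔-sym T-homᵇ)

homCount : (N e : ℕ) → (Fin e → Fin e → Bool) → (Fin N → Fin N → Bool) → ℕ
homCount N e D A = ∑Maps N e (indicator ∘ homᵇ D A)

-- Overriding a map on the image of an injection

module Override {m n : ℕ} (s : Fin n → Fin m) (s-injective : Injective _≡_ _≡_ s) where

  image? : ∀ v → Dec (∃ λ j → s j ≡ v)
  image? v = any? (λ j → s j Fin.≟ v)

  override : {X : Set} → (Fin m → X) → (Fin n → X) → Fin m → X
  override φ ψ v with image? v
  ... | yes (j , _) = ψ j
  ... | no _        = φ v

  module _ {X : Set} where

    override-image : ∀ (φ : Fin m → X) ψ j → override φ ψ (s j) ≡ ψ j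
    override-image φ ψ j with image? (s j)
    ... | yes (i , sᵢ≡sⱼ) = cong ψ (s-injective sᵢ≡sⱼ)
    ... | no  sⱼ∉         = contradiction (j , refl) sⱼ∉

    override-outside : ∀ (φ : Fin m → X) ψ {v} → ¬ (∃ λ j → s j ≡ v) → override φ ψ v ≡ φ v
    override-outside φ ψ {v} v∉ with image? v
    ... | yes v∈ = contradiction v∈ v∉
    ... | no  _  = refl

    override-cong : ∀ {φ φ′ : Fin m → X} {ψ ψ′} → φ ≗ φ′ → ψ ≗ ψ′ → override φ ψ ≗ override φ′ ψ′
    override-cong φ≗φ′ ψ≗ψ′ v with image? v
    ... | yes (j , _) = ψ≗ψ′ j
    ... | no  _       = φ≗φ′ v

    override-override : ∀ (φ : Fin m → X) ψ ψ′ → override (override φ ψ) ψ′ ≗ override φ ψ′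
    override-override φ ψ ψ′ v with image? v
    ... | yes _  = refl
    ... | no  v∉ = override-outside φ ψ v∉

    override-restriction : ∀ (φ : Fin m → X) → override φ (φ ∘ s) ≗ φ
    override-restriction φ v with image? v
    ... | yes (j , sⱼ≡v) = cong φ sⱼ≡v
    ... | no  _          = refl

  module _ {X : Set} where

    left : (Fin (m + n) → X) → Fin m → X
    left Φ = Φ ∘ (_↑ˡ n)

    right : (Fin (m + n) → X) → Fin n → X
    right Φ = Φ ∘ (m ↑ʳ_)

    left++right : ∀ Φ → left Φ ++ right Φ ≗ Φ
    left++right Φ i = trans ([,]-join (splitAt m i)) (cong Φ (join-splitAt m n i))
      where
      [,]-join : ∀ p → [ left Φ , right Φ ]′ p ≡ Φ (join m n p)
      [,]-join (inj₁ _) = refl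
      [,]-join (inj₂ _) = refl

    exchange : (Fin (m + n) → X) → Fin (m + n) → X
    exchange Φ = override (left Φ) (right Φ) ++ (left Φ ∘ s)

    exchange-cong : exchange Preserves _≗_ ⟶ _≗_
    exchange-cong Φ≗Φ′ = ++-cong _ _ (override-cong (Φ≗Φ′ ∘ (_↑ˡ n)) (Φ≗Φ′ ∘ (m ↑ʳ_))) (Φ≗Φ′ ∘ (_↑ˡ n) ∘ s)

    exchange-involutive : ∀ Φ → exchange (exchange Φ) ≗ Φ
    exchange-involutive Φ i = trans (++-cong _ _ on-left on-right i) (left++right Φ i)
      where
      φ = left Φ
      ψ = right Φ
      on-left : override (left (exchange Φ)) (right (exchange Φ)) ≗ φ
      on-left v = trans (override-cong (lookup-++ˡ (override φ ψ) (φ ∘ s)) (lookup-++ʳ (override φ ψ) (φ ∘ s)) v)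
                        (trans (override-override φ ψ (φ ∘ s) v) (override-restriction φ v))
      on-right : left (exchange Φ) ∘ s ≗ ψ
      on-right r = trans (lookup-++ˡ (override φ ψ) (φ ∘ s) (s r)) (override-image φ ψ r)

  ∑Maps-override : ∀ {e} {G : (Fin m → Fin e) → ℕ} → G Preserves _≗_ ⟶ _≡_ →
                   ∑Maps m e (λ φ → ∑Maps n e (λ ψ → G (override φ ψ))) ≡ e ^ n * ∑Maps m e G
  ∑Maps-override {e} {G} G-cong = begin
    ∑Maps m e (λ φ → ∑Maps n e (λ ψ → G (override φ ψ)))
      ≡⟨ ∑Maps-cong {m} (λ φ → ∑Maps-cong {n} λ ψ →
           G-cong (λ v → sym (trans (lookup-++ˡ _ _ v) (override-cong (lookup-++ˡ φ ψ) (lookup-++ʳ φ ψ) v)))) ⟩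
    ∑Maps m e (λ φ → ∑Maps n e (λ ψ → G (left (exchange (φ ++ ψ)))))
      ≡⟨ ∑Maps-split m n e (λ Φ≗Φ′ → G-cong (exchange-cong Φ≗Φ′ ∘ (_↑ˡ n))) ⟨
    ∑Maps (m + n) e (λ Φ → G (left (exchange Φ)))
      ≡⟨ ∑Maps-involution exchange-cong exchange-involutive (λ Φ≗Φ′ → G-cong (Φ≗Φ′ ∘ (_↑ˡ n))) ⟩
    ∑Maps (m + n) e (λ Φ → G (left Φ))
      ≡⟨ ∑Maps-split m n e (λ Φ≗Φ′ → G-cong (Φ≗Φ′ ∘ (_↑ˡ n))) ⟩
    ∑Maps m e (λ φ → ∑Maps n e (λ ψ → G (left (φ ++ ψ))))
      ≡⟨ ∑Maps-cong {m} (λ φ → ∑Maps-cong {n} λ ψ → G-cong (lookup-++ˡ φ ψ)) ⟩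
    ∑Maps m e (λ φ → ∑Maps n e (λ _ → G φ))
      ≡⟨ ∑Maps-cong {m} (λ φ → ∑Maps-const n e (G φ)) ⟩
    ∑Maps m e (λ φ → e ^ n * G φ)
      ≡⟨ *-distribˡ-∑Maps (e ^ n) G ⟨
    e ^ n * ∑Maps m e G ∎
    where open ≡-Reasoning

T-inS : ∀ {m n} (H : SimpleGraph m) (g : Fin n → Fin m) k v → T (inS H g k v) ⇔ (∃ λ j → g j ≡ v)
T-inS {n = zero}  H g k v = mk⇔ (λ ()) (λ ())
T-inS {n = suc n} H g k v with g zero Fin.≟ v
... | yes g₀≡v = mk⇔ (λ _ → zero , g₀≡v) _
... | no  g₀≢v = mk⇔ (λ t → let (j , gⱼ≡v) = to IH t in suc j , gⱼ≡v)
                     (λ { (zero , g₀≡v) → contradiction g₀≡v g₀≢v ; (suc j , gⱼ≡v) → from IH (j , gⱼ≡v) })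
  where IH = T-inS H (g ∘ suc) k v

module HölderExtension {m n : ℕ} (H : SimpleGraph m) (s : Fin n → Fin m)
                       (s-injective : Injective _≡_ _≡_ s) where

  open Override s s-injective

  module _ {X : Set} (D : X → X → Bool) {j : ℕ} (φ : Fin m → X) (ψ : Fin j → Fin n → X) where

    IsHom-extAdj′⇐ : IsHom D (adj H) φ → (∀ i → IsHom D (adj H) (override φ (ψ i))) →
                     IsHom D (extAdj' H s (suc j)) [ φ , uncurry ψ ]′
    IsHom-extAdj′⇐ hom-φ hom-copy (inj₁ u) (inj₁ w) a = hom-φ u w a
    IsHom-extAdj′⇐ hom-φ hom-copy (inj₁ u) (inj₂ (i , r)) a =
      let (u∉S , sᵣ~u) = to (T-unless (inS H s (suc j) u)) a in
      subst-D D (override-outside φ (ψ i) (u∉S ∘ from (T-inS H s (suc j) u))) (override-image φ (ψ i) r)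
              (hom-copy i u (s r) (subst T (SimpleGraph.sym H (s r) u) sᵣ~u))
    IsHom-extAdj′⇐ hom-φ hom-copy (inj₂ (i , r)) (inj₁ w) a =
      let (w∉S , sᵣ~w) = to (T-unless (inS H s (suc j) w)) a in
      subst-D D (override-image φ (ψ i) r) (override-outside φ (ψ i) (w∉S ∘ from (T-inS H s (suc j) w)))
              (hom-copy i (s r) w sᵣ~w)
    IsHom-extAdj′⇐ hom-φ hom-copy (inj₂ (i , r)) (inj₂ (i′ , r′)) a
      with to (T-if-else-false ⌊ i Fin.≟ i′ ⌋) a
    ... | i≟i′ , sᵣ~sᵣ′ with toWitness i≟i′
    ... | refl = subst-D D (override-image φ (ψ i) r) (override-image φ (ψ i) r′) (hom-copy i (s r) (s r′) sᵣ~sᵣ′)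

    IsHom-extAdj′⇒ : IsHom D (extAdj' H s (suc j)) [ φ , uncurry ψ ]′ →
                     IsHom D (adj H) φ × (∀ i → IsHom D (adj H) (override φ (ψ i)))
    IsHom-extAdj′⇒ homG = (λ u w → homG (inj₁ u) (inj₁ w)) , copy
      where
      copy : ∀ i → IsHom D (adj H) (override φ (ψ i))
      -- Matching on image? u and image? w makes override φ (ψ i) compute at u and w.
      copy i u w u~w with image? u | image? w
      ... | yes (r , refl) | yes (r′ , refl) =
        homG (inj₂ (i , r)) (inj₂ (i , r′)) (from (T-if-else-false ⌊ i Fin.≟ i ⌋) (fromWitness refl , u~w))
      ... | yes (r , refl) | no w∉S =
        homG (inj₂ (i , r)) (inj₁ w) (from (T-unless (inS H s (suc j) w)) (w∉S ∘ to (T-inS H s (suc j) w) , u~w))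
      ... | no u∉S | yes (r′ , refl) =
        homG (inj₁ u) (inj₂ (i , r′)) (from (T-unless (inS H s (suc j) u))
          (u∉S ∘ to (T-inS H s (suc j) u) , subst T (SimpleGraph.sym H u (s r′)) u~w))
      ... | no u∉S | no w∉S = homG (inj₁ u) (inj₁ w) u~w

    IsHom-extAdj′ : IsHom D (extAdj' H s (suc j)) [ φ , uncurry ψ ]′ ⇔
                    (IsHom D (adj H) φ × ∀ i → IsHom D (adj H) (override φ (ψ i)))
    IsHom-extAdj′ = mk⇔ IsHom-extAdj′⇒ (uncurry IsHom-extAdj′⇐)

  module _ {j : ℕ} where

    encode : HVert H s (suc j) → Fin (m + j * n)
    encode (inj₁ u)       = u ↑ˡ (j * n)
    encode (inj₂ (i , r)) = m ↑ʳ combine i r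

    decode≡[,] : ∀ x → decode H s (suc j) x ≡ [ inj₁ , inj₂ ∘ remQuot n ]′ (splitAt m x)
    decode≡[,] x with splitAt m x
    ... | inj₁ _ = refl
    ... | inj₂ _ = refl

    decode∘encode : ∀ a → decode H s (suc j) (encode a) ≡ a
    decode∘encode (inj₁ u) =
      trans (decode≡[,] _) (cong [ inj₁ , inj₂ ∘ remQuot n ]′ (splitAt-↑ˡ m u (j * n)))
    decode∘encode (inj₂ (i , r)) =
      trans (decode≡[,] _) (trans (cong [ inj₁ , inj₂ ∘ remQuot n ]′ (splitAt-↑ʳ m (j * n) (combine i r)))
                                  (cong inj₂ (remQuot-combine i r)))

    encode∘decode : ∀ x → encode (decode H s (suc j) x) ≡ x
    encode∘decode x = trans (cong encode (decode≡[,] x)) (trans (encode-[,] (splitAt m x)) (join-splitAt m (j * n) x))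
      where
      encode-[,] : ∀ p → encode ([ inj₁ , inj₂ ∘ remQuot n ]′ p) ≡ join m (j * n) p
      encode-[,] (inj₁ u) = refl
      encode-[,] (inj₂ y) = cong (m ↑ʳ_) (combine-remQuot {j} n y)

    copies : ∀ {X : Set} → (Fin (j * n) → X) → Fin j → Fin n → X
    copies χ i r = χ (combine i r)

    ++∘encode : ∀ {X : Set} (φ : Fin m → X) χ → (φ ++ χ) ∘ encode ≗ [ φ , uncurry (copies χ) ]′
    ++∘encode φ χ (inj₁ u)       = lookup-++ˡ φ χ u
    ++∘encode φ χ (inj₂ (i , r)) = lookup-++ʳ φ χ (combine i r)

    homᵇ-extAdj : ∀ {X : Set} (D : X → X → Bool) φ χ →
                  homᵇ D (extAdj H s (suc j)) (φ ++ χ) ≡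
                  (homᵇ D (adj H) φ ∧ allFin j (λ i → homᵇ D (adj H) (override φ (copies χ i))))
    homᵇ-extAdj D φ χ = T-injective
      (T-homᵇ D ⟨⇔⟩ IsHom-reindex D (decode H s (suc j)) encode decode∘encode encode∘decode
                ⟨⇔⟩ IsHom-cong D (++∘encode φ χ)
                ⟨⇔⟩ IsHom-extAdj′ D φ (copies χ)
                ⟨⇔⟩ (⇔-sym (T-homᵇ D) ×-⇔ (Π-⇔ (λ _ → ⇔-sym (T-homᵇ D)) ⟨⇔⟩ ⇔-sym (T-allFin j)))
                ⟨⇔⟩ ⇔-sym T-∧)

  module _ {e : ℕ} (D : Fin e → Fin e → Bool) where

    extensionCount : (Fin m → Fin e) → ℕ
    extensionCount φ = ∑Maps n e (λ ψ → indicator (homᵇ D (adj H) (override φ ψ)))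

    extensionCount-cong : extensionCount Preserves _≗_ ⟶ _≡_
    extensionCount-cong φ≗φ′ =
      ∑Maps-cong {n} λ ψ → cong indicator (homᵇ-cong D (override-cong φ≗φ′ (λ _ → refl)))

    extensionCount-override : ∀ φ ψ → extensionCount (override φ ψ) ≡ extensionCount φ
    extensionCount-override φ ψ =
      ∑Maps-cong {n} λ ψ′ → cong indicator (homᵇ-cong D (override-override φ ψ ψ′))

    homCount-extAdj : ∀ j → homCount (m + j * n) e D (extAdj H s (suc j))
                            ≡ ∑Maps m e (λ φ → indicator (homᵇ D (adj H) φ) * extensionCount φ ^ j)
    homCount-extAdj j = begin
      ∑Maps (m + j * n) e (indicator ∘ homᵇ D (extAdj H s (suc j)))
        ≡⟨ ∑Maps-split m (j * n) e (cong indicator ∘ homᵇ-cong D) ⟩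
      ∑Maps m e (λ φ → ∑Maps (j * n) e (λ χ → indicator (homᵇ D (extAdj H s (suc j)) (φ ++ χ))))
        ≡⟨ ∑Maps-cong {m} (λ φ → ∑Maps-cong {j * n} λ χ →
             trans (cong indicator (homᵇ-extAdj D φ χ)) (indicator-∧ _ (copiesHom φ χ))) ⟩
      ∑Maps m e (λ φ → ∑Maps (j * n) e (λ χ → indicator (homᵇ D (adj H) φ) * indicator (copiesHom φ χ)))
        ≡⟨ ∑Maps-cong {m} (λ φ → *-distribˡ-∑Maps {j * n} (indicator (homᵇ D (adj H) φ)) _) ⟨
      ∑Maps m e (λ φ → indicator (homᵇ D (adj H) φ) * ∑Maps (j * n) e (indicator ∘ copiesHom φ))
        ≡⟨ ∑Maps-cong {m} (λ φ → cong (indicator (homᵇ D (adj H) φ) *_)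
             (∑Maps-allFin j (homᵇ-cong D ∘ override-cong (λ _ → refl)))) ⟩
      ∑Maps m e (λ φ → indicator (homᵇ D (adj H) φ) * extensionCount φ ^ j) ∎
      where
      open ≡-Reasoning
      copiesHom : (Fin m → Fin e) → (Fin (j * n) → Fin e) → Bool
      copiesHom φ χ = allFin j (λ i → homᵇ D (adj H) (override φ (copies χ i)))

    ∑-extensionCount : ∑Maps m e extensionCount ≡ e ^ n * homCount m e D (adj H)
    ∑-extensionCount = ∑Maps-override (cong indicator ∘ homᵇ-cong D)

    ∑-extensionCount-^ : ∀ j → ∑Maps m e (λ φ → extensionCount φ ^ suc j)
                               ≡ e ^ n * homCount (m + j * n) e D (extAdj H s (suc j))
    ∑-extensionCount-^ j = begin
      ∑Maps m e (λ φ → extensionCount φ ^ suc j)              ≡⟨ ∑Maps-cong {m} power-as-sum ⟩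
      ∑Maps m e (λ φ → ∑Maps n e (λ ψ → weight (override φ ψ))) ≡⟨ ∑Maps-override weight-cong ⟩
      e ^ n * ∑Maps m e weight                                ≡⟨ cong (e ^ n *_) (homCount-extAdj j) ⟨
      e ^ n * homCount (m + j * n) e D (extAdj H s (suc j))   ∎
      where
      open ≡-Reasoning
      weight : (Fin m → Fin e) → ℕ
      weight φ = indicator (homᵇ D (adj H) φ) * extensionCount φ ^ j

      weight-cong : weight Preserves _≗_ ⟶ _≡_
      weight-cong φ≗φ′ = cong₂ _*_ (cong indicator (homᵇ-cong D φ≗φ′)) (cong (_^ j) (extensionCount-cong φ≗φ′))

      power-as-sum : ∀ φ → extensionCount φ ^ suc j ≡ ∑Maps n e (λ ψ → weight (override φ ψ))
      power-as-sum φ = begin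
        extensionCount φ * extensionCount φ ^ j
          ≡⟨ *-comm (extensionCount φ) _ ⟩
        extensionCount φ ^ j * extensionCount φ
          ≡⟨ *-distribˡ-∑Maps {n} (extensionCount φ ^ j) _ ⟩
        ∑Maps n e (λ ψ → extensionCount φ ^ j * indicator (homᵇ D (adj H) (override φ ψ)))
          ≡⟨ ∑Maps-cong {n} (λ ψ → trans (*-comm (extensionCount φ ^ j) _)
               (cong (λ c → indicator (homᵇ D (adj H) (override φ ψ)) * c ^ j) (sym (extensionCount-override φ ψ)))) ⟩
        ∑Maps n e (λ ψ → weight (override φ ψ)) ∎

    homCount-Hölder : ∀ k → 1 ≤ k → .{{_ : NonZero e}} →
                      homCount m e D (adj H) ^ k
                        ≤ homCount (m + (k ∸ 1) * n) e D (extAdj H s k) * e ^ ((k ∸ 1) * (m ∸ n))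
    homCount-Hölder (suc j) _ = subst (λ x → NH ^ suc j ≤ NG * x) (trans (^-*-assoc e l j) (cong (e ^_) (*-comm l j)))
      (^-*-cancelˡ-≤ (e ^ n) (e ^ l) NH NG j {{m^n≢0 e n}} (subst₂ _≤_
        (cong (_^ suc j) ∑-extensionCount)
        (cong₂ (λ M y → M ^ j * y) e^m≡e^n*e^l (∑-extensionCount-^ j))
        (∑Maps-power-mean extensionCount j)))
      where
      l = m ∸ n
      NH = homCount m e D (adj H)
      NG = homCount (m + j * n) e D (extAdj H s (suc j))
      e^m≡e^n*e^l : e ^ m ≡ e ^ n * e ^ l
      e^m≡e^n*e^l = trans (cong (e ^_) (sym (m+[n∸m]≡n (injective⇒≤ s-injective)))) (^-distribˡ-+-* e n l)

-- The inequality holds for homomorphism counts into any graph on E.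
mainTheorem2 : {c ℓ : Level} (q : ℕ) (F : CommutativeRing c ℓ) (fF : IsFiniteField F q) →
    OddPrimePower q →
    (d : ℕ) → 2 ≤ d →
    (t : CommutativeRing.Carrier F) → ¬ (CommutativeRing._≈_ F t (CommutativeRing.0# F)) →
    (e : ℕ) → 1 ≤ e →
    (E : Fin e → (Fin d → CommutativeRing.Carrier F)) →
    (∀ i j → (∀ r → CommutativeRing._≈_ F (E i r) (E j r)) → i ≡ j) →
    (m n : ℕ) (H : SimpleGraph m) (s : Fin n → Fin m) →
    (∀ i j → s i ≡ s j → i ≡ j) →
    (k : ℕ) → 1 ≤ k →
    embCount F (IsFiniteField._≟_ fF) d t E (adj H) ^ k
      ≤ embCount F (IsFiniteField._≟_ fF) d t E (extAdj H s k) * e ^ ((k ∸ 1) * (m ∸ n))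
mainTheorem2 q F fF _ d _ t _ e 1≤e E _ m n H s s-injective k 1≤k =
  subst₂ (λ NH NG → NH ^ k ≤ NG * e ^ ((k ∸ 1) * (m ∸ n)))
         (sym (countMaps≡∑Maps m e _)) (sym (countMaps≡∑Maps (m + (k ∸ 1) * n) e _))
         (HölderExtension.homCount-Hölder H s (s-injective _ _) distance-t k 1≤k {{>-nonZero 1≤e}})
  where
  distance-t : Fin e → Fin e → Bool
  distance-t a b = ⌊ IsFiniteField._≟_ fF (dist F d (E a) (E b)) t ⌋
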